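{- Let $S$ be a finite left regular band with identity, $L$ its support lattice, and $k$ a field. For each $X\in L$ fix $x_X\in S$ with $\operatorname{supp}(x_X)=X$, and define $e_X=x_X-\sum_{Y>X}x_Xe_Y$ recursively. Then the set $\{x\,e_{\operatorname{supp}(x)}: x\in S\}$ is a basis of $kS$ consisting of primitive idempotents (not necessarily orthogonal).
   Context: A left regular band is a semigroup $S$ with $x^2=x$ and $xyx=xy$ for all $x,y\in S$. Define the preorder $y\preceq x$ iff $xy=x$; identifying $x,y$ when $x\preceq y\preceq x$ gives the support lattice $L$ (a finite lattice) with quotient map $\operatorname{supp}:S\to L$, satisfying $\operatorname{supp}(xy)=\operatorname{supp}(x)\vee\operatorname{supp}(y)$ and $xy=x$ iff $\operatorname{supp}(y)\le\operatorname{supp}(x)$. An idempotent is primitive if it is not a sum of two nonzero orthogonal idempotents. -}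

module Defs where

open import Level using (Level; _⊔_)
open import Data.Nat using (ℕ; zero; suc)
open import Data.Fin using (Fin; zero; suc)
open import Data.Fin.Properties using (_≟_)
open import Data.Product using (Σ; ∃; _×_; _,_)
open import Relation.Nullary using (¬_; Dec; yes; no)
open import Relation.Nullary.Decidable using (_×-dec_; ¬?)
open import Relation.Binary.PropositionalEquality using (_≡_)
open import Algebra.Bundles using (CommutativeRing)

record Field (c ℓ : Level) : Set (Level.suc (c ⊔ ℓ)) where
  field
    commutativeRing : CommutativeRing c ℓ
  open CommutativeRing commutativeRing public
  field
    1≉0     : ¬ (1# ≈ 0#)
    inverse : ∀ x → ¬ (x ≈ 0#) → Σ Carrier λ y → x * y ≈ 1#

record LRBWithIdentity (n : ℕ) : Set where
  field
    _·_    : Fin n → Fin n → Fin n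
    assoc  : ∀ x y z → (x · y) · z ≡ x · (y · z)
    idem   : ∀ x → x · x ≡ x
    leftRegular : ∀ x y → (x · y) · x ≡ x · y
    one    : Fin n
    identityˡ : ∀ x → one · x ≡ x
    identityʳ : ∀ x → x · one ≡ x

  -- y ⪯ x  iff  x y = x   (i.e. supp y ≤ supp x)
  _⪯_ : Fin n → Fin n → Set
  y ⪯ x = x · y ≡ x

  _∼_ : Fin n → Fin n → Set
  x ∼ y = (x ⪯ y) × (y ⪯ x)

  _≺_ : Fin n → Fin n → Set
  x ≺ y = (x ⪯ y) × ¬ (y ⪯ x)

  _⪯?_ : ∀ y x → Dec (y ⪯ x)
  y ⪯? x = (x · y) ≟ x

  _≺?_ : ∀ x y → Dec (x ≺ y)
  x ≺? y = (x ⪯? y) ×-dec ¬? (y ⪯? x)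

-- A choice of one element x_X in each support class X ∈ L:
-- rep x is the chosen element of the class supp(x); it has the same
-- support as x and depends only on supp(x).
record Representatives {n : ℕ} (S : LRBWithIdentity n) : Set where
  open LRBWithIdentity S
  field
    rep      : Fin n → Fin n
    rep-∼    : ∀ x → rep x ∼ x
    rep-cong : ∀ x y → x ∼ y → rep x ≡ rep y

module SemigroupAlgebra {c ℓ : Level} (K : Field c ℓ) {n : ℕ}
                        (S : LRBWithIdentity n) where
  open Field K using (Carrier; _≈_; 0#; 1#; _+_; _*_; _-_)
  open LRBWithIdentity S

  kS : Set c
  kS = Fin n → Carrier

  ∑ : ∀ {m} → (Fin m → Carrier) → Carrier
  ∑ {zero}  f = 0#
  ∑ {suc m} f = f zero + ∑ (λ i → f (suc i))

  ∑[_∣_] : ∀ {m} {P : Fin m → Set} → (∀ i → Dec (P i)) → (Fin m → Carrier) → Carrier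
  ∑[ P? ∣ f ] = ∑ (λ i → cond (P? i) (f i))
    where
      cond : ∀ {A : Set} → Dec A → Carrier → Carrier
      cond (yes _) a = a
      cond (no _)  _ = 0#

  _≋_ : kS → kS → Set ℓ
  a ≋ b = ∀ z → a z ≈ b z

  𝟘 : kS
  𝟘 _ = 0#

  _⊕_ : kS → kS → kS
  (a ⊕ b) z = a z + b z

  _⊖_ : kS → kS → kS
  (a ⊖ b) z = a z - b z

  _⊛_ : Carrier → kS → kS
  (λ' ⊛ a) z = λ' * a z

  δ : Fin n → kS
  δ s z with s ≟ z
  ... | yes _ = 1#
  ... | no  _ = 0#

  _⊗_ : kS → kS → kS
  (a ⊗ b) z = ∑ λ x → ∑[ (λ y → (x · y) ≟ z) ∣ (λ y → a x * b y) ]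

  ∑ᵥ : ∀ {m} → (Fin m → kS) → kS
  ∑ᵥ f z = ∑ λ i → f i z

  ∑ᵥ[_∣_] : ∀ {m} {P : Fin m → Set} → (∀ i → Dec (P i)) → (Fin m → kS) → kS
  ∑ᵥ[ P? ∣ f ] z = ∑[ P? ∣ (λ i → f i z) ]

  IsBasis : ∀ {m} → (Fin m → kS) → Set (c ⊔ ℓ)
  IsBasis b =
    (∀ (λs : Fin _ → Carrier) → ∑ᵥ (λ i → λs i ⊛ b i) ≋ 𝟘 → ∀ i → λs i ≈ 0#)
    × (∀ (v : kS) → Σ (Fin _ → Carrier) λ λs → v ≋ ∑ᵥ (λ i → λs i ⊛ b i))

  IsIdempotent : kS → Set ℓ
  IsIdempotent f = (f ⊗ f) ≋ f

  IsPrimitiveIdempotent : kS → Set (c ⊔ ℓ)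
  IsPrimitiveIdempotent f =
    IsIdempotent f × ¬ (f ≋ 𝟘) ×
    ¬ (Σ kS λ g → Σ kS λ h →
         IsIdempotent g × IsIdempotent h × ¬ (g ≋ 𝟘) × ¬ (h ≋ 𝟘) ×
         (g ⊗ h) ≋ 𝟘 × (h ⊗ g) ≋ 𝟘 × f ≋ (g ⊕ h))

  module _ (R : Representatives S) where
    open Representatives R

    -- e_X = x_X − Σ_{Y > X} x_X e_Y, indexed here by elements x with
    -- X = supp(x) (so eOf x = e_{supp x}); Y ranges over L via its
    -- chosen representatives y (rep y ≡ y).  The recursion is on the
    -- finite poset L; it is implemented with fuel, and fuel n suffices
    -- since every chain in L has fewer than n+1 elements, so the base
    -- case is never reached from eOf.
    eFuel : ℕ → Fin n → kS
    eFuel zero    x = δ (rep x)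
    eFuel (suc k) x =
      δ (rep x) ⊖ ∑ᵥ[ (λ y → (rep y ≟ y) ×-dec (rep x ≺? y)) ∣
                      (λ y → δ (rep x) ⊗ eFuel k y) ]

    eOf : Fin n → kS
    eOf x = eFuel n x

-- The key fact is that left multiplication by s annihilates e_X unless supp s ≤ X.
-- By downward induction on X: with t = s x_X, the recursion gives
-- s e_X = t − Σ_{Y > X} t e_Y; the summand for Y = supp t is again t minus the
-- summands for Y > supp t, and every other summand vanishes by induction.
-- Consequently x e_{supp x} is idempotent and unitriangular for the support order,
-- so these elements form a basis. For primitivity, the characters
-- χ_Y(s) = [supp s ≤ Y] are algebra maps kS → k vanishing on x e_{supp x} for
-- Y ≠ supp x, and an idempotent killed by every character is zero. If
-- x e_{supp x} = g + h with g, h orthogonal idempotents, then for Y ≠ supp x both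
-- χ_Y(g) and χ_Y(h) vanish, while χ_{supp x}(g) χ_{supp x}(h) = 0 in the field
-- forces g = 0 or h = 0.

module Submission where

open import Defs
open import Level using (Level; _⊔_)
open import Data.Bool using (if_then_else_)
open import Data.Empty using (⊥-elim)
open import Data.Fin using (Fin; zero; suc)
open import Data.Fin.Properties using (_≟_; punchInᵢ≢i)
open import Data.Fin.Subset using (Subset; inside; outside; _∈_; ∣_∣)
open import Data.Fin.Subset.Properties using (p⊂q⇒∣p∣<∣q∣; ∈⊤; ∣⊤∣≡n)
open import Data.Fin.Induction using (spo-wellFounded; spo-noetherian)
open import Data.Nat using (ℕ; zero; suc; _<_; s≤s)
open import Data.Nat.Properties using (<-≤-trans; m<n⇒m<1+n)
open import Data.Product using (Σ; _×_; _,_; proj₁; proj₂)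
open import Data.Vec using (tabulate)
open import Data.Vec.Functional using (removeAt)
open import Data.Vec.Properties using (lookup∘tabulate; lookup⇒[]=; []=⇒lookup)
open import Function using (flip)
open import Induction.WellFounded using (WellFounded; module All)
open import Relation.Binary.Structures using (IsStrictPartialOrder)
open import Relation.Binary.PropositionalEquality as ≡ using (_≡_; _≢_; module ≡-Reasoning)
open import Relation.Nullary using (¬_; Dec; yes; no; does)
open import Relation.Nullary.Decidable using (dec-true; _×-dec_)

module LeftRegularBandOrder {n : ℕ} (S : LRBWithIdentity n) where
  open LRBWithIdentity S renaming (_·_ to infixl 30 _·_)

  ⪯-refl : ∀ x → x ⪯ x
  ⪯-refl = idem

  ⪯-trans : ∀ {x y z} → x ⪯ y → y ⪯ z → x ⪯ z
  ⪯-trans {x} {y} {z} y·x≡y z·y≡z = begin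
    z · x        ≡⟨ ≡.cong (_· x) (≡.sym z·y≡z) ⟩
    (z · y) · x  ≡⟨ assoc z y x ⟩
    z · (y · x)  ≡⟨ ≡.cong (z ·_) y·x≡y ⟩
    z · y        ≡⟨ z·y≡z ⟩
    z            ∎
    where open ≡-Reasoning

  x⪯x·y : ∀ x y → x ⪯ x · y
  x⪯x·y = leftRegular

  y⪯x·y : ∀ x y → y ⪯ x · y
  y⪯x·y x y = ≡.trans (assoc x y y) (≡.cong (x ·_) (idem y))

  ·-lub : ∀ {x y z} → x ⪯ z → y ⪯ z → x · y ⪯ z
  ·-lub {x} {y} {z} z·x≡z z·y≡z =
    ≡.trans (≡.sym (assoc z x y)) (≡.trans (≡.cong (_· y) z·x≡z) z·y≡z)

  x·y⪯x⇒x·y≡x : ∀ {x y} → x · y ⪯ x → x · y ≡ x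
  x·y⪯x⇒x·y≡x {x} {y} x·[x·y]≡x = begin
    x · y        ≡⟨ ≡.cong (_· y) (≡.sym (idem x)) ⟩
    (x · x) · y  ≡⟨ assoc x x y ⟩
    x · (x · y)  ≡⟨ x·[x·y]≡x ⟩
    x            ∎
    where open ≡-Reasoning

  ≺-irrefl : ∀ {x} → ¬ (x ≺ x)
  ≺-irrefl (x⪯x , x⋠x) = x⋠x x⪯x

  ≺-⪯-trans : ∀ {x y z} → x ≺ y → y ⪯ z → x ≺ z
  ≺-⪯-trans (x⪯y , y⋠x) y⪯z = ⪯-trans x⪯y y⪯z , λ z⪯x → y⋠x (⪯-trans y⪯z z⪯x)

  ⪯-≺-trans : ∀ {x y z} → x ⪯ y → y ≺ z → x ≺ z
  ⪯-≺-trans x⪯y (y⪯z , z⋠y) = ⪯-trans x⪯y y⪯z , λ z⪯x → z⋠y (⪯-trans z⪯x x⪯y)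

  ≺-trans : ∀ {x y z} → x ≺ y → y ≺ z → x ≺ z
  ≺-trans x≺y (y⪯z , _) = ≺-⪯-trans x≺y y⪯z

  ≺-isStrictPartialOrder : IsStrictPartialOrder _≡_ _≺_
  ≺-isStrictPartialOrder = record
    { isEquivalence = ≡.isEquivalence
    ; irrefl        = λ { ≡.refl → ≺-irrefl }
    ; trans         = ≺-trans
    ; <-resp-≈      = ≡.resp₂ _≺_
    }

  ≺-wellFounded : WellFounded _≺_
  ≺-wellFounded = spo-wellFounded ≺-isStrictPartialOrder

  ≻-wellFounded : WellFounded (flip _≺_)
  ≻-wellFounded = spo-noetherian ≺-isStrictPartialOrder

  strictUpset : Fin n → Subset n
  strictUpset x = tabulate λ z → if does (x ≺? z) then inside else outside

  ∈-strictUpset⁺ : ∀ {x z} → x ≺ z → z ∈ strictUpset x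
  ∈-strictUpset⁺ {x} {z} x≺z = lookup⇒[]= z _
    (≡.trans (lookup∘tabulate _ z) (≡.cong (if_then inside else outside) (dec-true (x ≺? z) x≺z)))

  ∈-strictUpset⁻ : ∀ {x z} → z ∈ strictUpset x → x ≺ z
  ∈-strictUpset⁻ {x} {z} z∈ =
    inside⇒holds (x ≺? z) (≡.trans (≡.sym (lookup∘tabulate _ z)) ([]=⇒lookup z∈))
    where
      inside⇒holds : ∀ {A : Set} (d : Dec A) → (if does d then inside else outside) ≡ inside → A
      inside⇒holds (yes a) _ = a
      inside⇒holds (no _)  ()

  #above : Fin n → ℕ
  #above x = ∣ strictUpset x ∣

  #above<n : ∀ x → #above x < n
  #above<n x = ≡.subst (#above x <_) (∣⊤∣≡n n)
    (p⊂q⇒∣p∣<∣q∣ ((λ _ → ∈⊤) , x , ∈⊤ , λ x∈ → ≺-irrefl (∈-strictUpset⁻ x∈)))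

  #above-≺ : ∀ {x y} → x ≺ y → #above y < #above x
  #above-≺ {x} {y} x≺y = p⊂q⇒∣p∣<∣q∣
    ( (λ z∈ → ∈-strictUpset⁺ (≺-⪯-trans x≺y (proj₁ (∈-strictUpset⁻ z∈))))
    , y , ∈-strictUpset⁺ x≺y , λ y∈ → ≺-irrefl (∈-strictUpset⁻ y∈))

module FieldSums {c ℓ : Level} (K : Field c ℓ) where
  open Field K hiding (zero)
  open import Algebra.Properties.Semiring.Sum semiring
  open import Algebra.Properties.Ring ring using (-1*x≈-x; -0#≈0#)
  open import Relation.Binary.Reasoning.Setoid setoid

  cond : {A : Set} → Dec A → Carrier → Carrier
  cond (yes _) a = a
  cond (no _)  _ = 0#

  cond-yes : ∀ {A : Set} (d : Dec A) {a} → A → cond d a ≈ a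
  cond-yes (yes _) _ = refl
  cond-yes (no ¬p) p = ⊥-elim (¬p p)

  cond-no : ∀ {A : Set} (d : Dec A) {a} → ¬ A → cond d a ≈ 0#
  cond-no (yes p) ¬p = ⊥-elim (¬p p)
  cond-no (no _)  _  = refl

  cond-congᵈ : ∀ {A : Set} (d : Dec A) {a b} → (A → a ≈ b) → cond d a ≈ cond d b
  cond-congᵈ (yes p) a≈b = a≈b p
  cond-congᵈ (no _)  _   = refl

  cond-cong : ∀ {A : Set} (d : Dec A) {a b} → a ≈ b → cond d a ≈ cond d b
  cond-cong d a≈b = cond-congᵈ d λ _ → a≈b

  cond-zeroᵈ : ∀ {A : Set} (d : Dec A) {a} → (A → a ≈ 0#) → cond d a ≈ 0#
  cond-zeroᵈ (yes p) a≈0 = a≈0 p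
  cond-zeroᵈ (no _)  _   = refl

  cond-*ˡ : ∀ {A : Set} (d : Dec A) a b → cond d (a * b) ≈ a * cond d b
  cond-*ˡ (yes _) a b = refl
  cond-*ˡ (no _)  a b = sym (zeroʳ a)

  cond-+ : ∀ {A : Set} (d : Dec A) a b → cond d (a + b) ≈ cond d a + cond d b
  cond-+ (yes _) a b = refl
  cond-+ (no _)  a b = sym (+-identityʳ 0#)

  cond-neg : ∀ {A : Set} (d : Dec A) a → cond d (- a) ≈ - cond d a
  cond-neg (yes _) a = refl
  cond-neg (no _)  a = sym -0#≈0#

  cond-sum : ∀ {A : Set} (d : Dec A) {m} (f : Fin m → Carrier) →
             cond d (sum f) ≈ sum (λ i → cond d (f i))
  cond-sum (yes _) f = refl
  cond-sum (no _) {m} f = sym (sum-replicate-zero m)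

  cond-comm : ∀ {A B : Set} (d : Dec A) (e : Dec B) a → cond d (cond e a) ≈ cond e (cond d a)
  cond-comm (yes _) (yes _) a = refl
  cond-comm (yes _) (no _)  a = refl
  cond-comm (no _)  (yes _) a = refl
  cond-comm (no _)  (no _)  a = refl

  cond-⇔ : ∀ {A B : Set} (d : Dec A) (e : Dec B) {a} → (A → B) → (B → A) → cond d a ≈ cond e a
  cond-⇔ (yes _) (yes _) _   _   = refl
  cond-⇔ (yes p) (no ¬q) A→B _   = ⊥-elim (¬q (A→B p))
  cond-⇔ (no ¬p) (yes q) _   B→A = ⊥-elim (¬p (B→A q))
  cond-⇔ (no _)  (no _)  _   _   = refl

  cond-*ʳ : ∀ {A : Set} (d : Dec A) a b → cond d (a * b) ≈ cond d a * b
  cond-*ʳ (yes _) a b = refl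
  cond-*ʳ (no _)  a b = sym (zeroˡ b)

  cond-× : ∀ {A B C : Set} (d : Dec A) (e : Dec B) (f : Dec C) {a} →
           (C → A) → (C → B) → (A → B → C) → cond f a ≈ cond d (cond e a)
  cond-× (yes p) (yes q) f         _   _   A→B→C = cond-yes f (A→B→C p q)
  cond-× (yes _) (no ¬q) f         _   C→B _     = cond-no f (λ r → ¬q (C→B r))
  cond-× (no ¬p) e       f         C→A _   _     = cond-no f (λ r → ¬p (C→A r))

  x*x≈x⇒x*y≈0⇒x+y≈0⇒x≈0 : ∀ {x y} → x * x ≈ x → x * y ≈ 0# → x + y ≈ 0# → x ≈ 0#
  x*x≈x⇒x*y≈0⇒x+y≈0⇒x≈0 {x} {y} x*x≈x x*y≈0 x+y≈0 = begin
    x                ≈⟨ x*x≈x ⟨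
    x * x            ≈⟨ +-identityʳ (x * x) ⟨
    x * x + 0#       ≈⟨ +-congˡ x*y≈0 ⟨
    x * x + x * y    ≈⟨ distribˡ x x y ⟨
    x * (x + y)      ≈⟨ *-congˡ x+y≈0 ⟩
    x * 0#           ≈⟨ zeroʳ x ⟩
    0#               ∎

  x≉0⇒x*y≈0⇒y≈0 : ∀ {x y} → ¬ (x ≈ 0#) → x * y ≈ 0# → y ≈ 0#
  x≉0⇒x*y≈0⇒y≈0 {x} {y} x≉0 x*y≈0 with inverse x x≉0
  ... | x⁻¹ , x*x⁻¹≈1 = begin
    y                ≈⟨ *-identityˡ y ⟨
    1# * y           ≈⟨ *-congʳ x*x⁻¹≈1 ⟨
    x * x⁻¹ * y      ≈⟨ *-congʳ (*-comm x x⁻¹) ⟩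
    x⁻¹ * x * y      ≈⟨ *-assoc x⁻¹ x y ⟩
    x⁻¹ * (x * y)    ≈⟨ *-congˡ x*y≈0 ⟩
    x⁻¹ * 0#         ≈⟨ zeroʳ x⁻¹ ⟩
    0#               ∎

  sum-zero : ∀ {m} {f : Fin m → Carrier} → (∀ i → f i ≈ 0#) → sum f ≈ 0#
  sum-zero {m} f≈0 = trans (sum-cong-≋ f≈0) (sum-replicate-zero m)

  sum-single : ∀ {m} {f : Fin m → Carrier} (t : Fin m) → (∀ i → i ≢ t → f i ≈ 0#) → sum f ≈ f t
  sum-single {suc m} {f} t f≈0 = begin
    sum f                     ≈⟨ sum-remove f ⟩
    f t + sum (removeAt f t)  ≈⟨ +-congˡ (sum-zero λ i → f≈0 _ (punchInᵢ≢i t i)) ⟩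
    f t + 0#                  ≈⟨ +-identityʳ (f t) ⟩
    f t                       ∎

  sum-neg : ∀ {m} (f : Fin m → Carrier) → sum (λ i → - f i) ≈ - sum f
  sum-neg f = begin
    sum (λ i → - f i)       ≈⟨ sum-cong-≋ (λ i → sym (-1*x≈-x (f i))) ⟩
    sum (λ i → - 1# * f i)  ≈⟨ *-distribˡ-sum (- 1#) f ⟨
    - 1# * sum f            ≈⟨ -1*x≈-x (sum f) ⟩
    - sum f                 ∎

  sum-cond-≡ : ∀ {m} (f : Fin m → Carrier) t → sum (λ i → cond (t ≟ i) (f i)) ≈ f t
  sum-cond-≡ f t = trans (sum-single t λ i i≢t → cond-no (t ≟ i) (λ t≡i → i≢t (≡.sym t≡i)))
                         (cond-yes (t ≟ t) ≡.refl)

  sum-cond-split : ∀ {m} {P Q : Fin m → Set} (P? : ∀ i → Dec (P i)) (Q? : ∀ i → Dec (Q i))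
                   (f : Fin m → Carrier) a → P a → ¬ Q a → (∀ {i} → Q i → P i) →
                   (∀ i → P i → i ≢ a → ¬ Q i → f i ≈ 0#) →
                   sum (λ i → cond (P? i) (f i)) ≈ f a + sum (λ i → cond (Q? i) (f i))
  sum-cond-split P? Q? f a Pa ¬Qa Q⇒P f≈0 = begin
    sum (λ i → cond (P? i) (f i))
      ≈⟨ sum-cong-≋ split ⟩
    sum (λ i → cond (a ≟ i) (f i) + cond (Q? i) (f i))
      ≈⟨ ∑-distrib-+ (λ i → cond (a ≟ i) (f i)) (λ i → cond (Q? i) (f i)) ⟩
    sum (λ i → cond (a ≟ i) (f i)) + sum (λ i → cond (Q? i) (f i))
      ≈⟨ +-congʳ (sum-cond-≡ f a) ⟩
    f a + sum (λ i → cond (Q? i) (f i)) ∎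
    where
      split : ∀ i → cond (P? i) (f i) ≈ cond (a ≟ i) (f i) + cond (Q? i) (f i)
      split i with a ≟ i
      ... | yes ≡.refl =
        trans (cond-yes (P? a) Pa) (sym (trans (+-congˡ (cond-no (Q? a) ¬Qa)) (+-identityʳ (f a))))
      ... | no a≢i with Q? i
      ...   | yes q = trans (cond-yes (P? i) (Q⇒P q)) (sym (+-identityˡ (f i)))
      ...   | no ¬q =
        trans (cond-zeroᵈ (P? i) λ p → f≈0 i p (λ i≡a → a≢i (≡.sym i≡a)) ¬q) (sym (+-identityˡ 0#))

module SemigroupAlgebraProperties {c ℓ : Level} (K : Field c ℓ) {n : ℕ} (S : LRBWithIdentity n) where
  open Field K hiding (zero)
  open LRBWithIdentity S renaming (_·_ to infixl 30 _·_)
  open SemigroupAlgebra K S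
    renaming ( _⊗_ to infixl 7 _⊗_; _⊛_ to infixr 7 _⊛_; _⊕_ to infixl 6 _⊕_; _⊖_ to infixl 6 _⊖_
             ; _≋_ to infix 4 _≋_)
  open LeftRegularBandOrder S
  open FieldSums K
  open import Algebra.Properties.Semiring.Sum semiring
  open import Algebra.Properties.AbelianGroup +-abelianGroup using (//-rightDividesˡ; x≈y⇒x∙y⁻¹≈ε)
  open import Relation.Binary.Reasoning.Setoid setoid

  ∑≡sum : ∀ {m} (f : Fin m → Carrier) → ∑ f ≡ sum f
  ∑≡sum {zero}  f = ≡.refl
  ∑≡sum {suc m} f = ≡.cong (f zero +_) (∑≡sum (λ i → f (suc i)))

  ∑[]≈sum : ∀ {m} {P : Fin m → Set} (P? : ∀ i → Dec (P i)) (f : Fin m → Carrier) →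
            ∑[ P? ∣ f ] ≈ sum (λ i → cond (P? i) (f i))
  ∑[]≈sum {zero}  P? f = refl
  ∑[]≈sum {suc m} P? f with P? zero
  ... | yes _ = +-congˡ (∑[]≈sum (λ i → P? (suc i)) (λ i → f (suc i)))
  ... | no _  = +-congˡ (∑[]≈sum (λ i → P? (suc i)) (λ i → f (suc i)))

  δ-self : ∀ t → δ t t ≈ 1#
  δ-self t with t ≟ t
  ... | yes _   = refl
  ... | no t≢t = ⊥-elim (t≢t ≡.refl)

  δ-≢ : ∀ {t z} → t ≢ z → δ t z ≈ 0#
  δ-≢ {t} {z} t≢z with t ≟ z
  ... | yes t≡z = ⊥-elim (t≢z t≡z)
  ... | no _    = refl

  δ-expand : ∀ (a : kS) → ∑ᵥ (λ s → a s ⊛ δ s) ≋ a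
  δ-expand a z = begin
    ∑ (λ s → a s * δ s z)
      ≡⟨ ∑≡sum (λ s → a s * δ s z) ⟩
    sum (λ s → a s * δ s z)
      ≈⟨ sum-single z (λ s s≢z → trans (*-congˡ (δ-≢ s≢z)) (zeroʳ (a s))) ⟩
    a z * δ z z
      ≈⟨ *-congˡ (δ-self z) ⟩
    a z * 1#
      ≈⟨ *-identityʳ (a z) ⟩
    a z ∎

  module _ {Q : Fin n → Set} (Q? : ∀ w → Dec (Q w)) where

    sumOver : kS → Carrier
    sumOver a = sum λ w → cond (Q? w) (a w)

    sumOver-congᵈ : ∀ {a b} → (∀ w → Q w → a w ≈ b w) → sumOver a ≈ sumOver b
    sumOver-congᵈ a≈b = sum-cong-≋ λ w → cond-congᵈ (Q? w) (a≈b w)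

    sumOver-cong : ∀ {a b} → a ≋ b → sumOver a ≈ sumOver b
    sumOver-cong a≋b = sumOver-congᵈ λ w _ → a≋b w

    sumOver-𝟘 : ∀ {a} → a ≋ 𝟘 → sumOver a ≈ 0#
    sumOver-𝟘 a≋𝟘 = sum-zero λ w → cond-zeroᵈ (Q? w) λ _ → a≋𝟘 w

    sumOver-⊕ : ∀ a b → sumOver (a ⊕ b) ≈ sumOver a + sumOver b
    sumOver-⊕ a b = trans (sum-cong-≋ λ w → cond-+ (Q? w) (a w) (b w))
                          (∑-distrib-+ (λ w → cond (Q? w) (a w)) (λ w → cond (Q? w) (b w)))

    sumOver-⊖ : ∀ a b → sumOver (a ⊖ b) ≈ sumOver a - sumOver b
    sumOver-⊖ a b = begin
      sumOver (a ⊖ b)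
        ≈⟨ sum-cong-≋ (λ w → trans (cond-+ (Q? w) _ _) (+-congˡ (cond-neg (Q? w) (b w)))) ⟩
      sum (λ w → cond (Q? w) (a w) + - cond (Q? w) (b w))
        ≈⟨ ∑-distrib-+ (λ w → cond (Q? w) (a w)) (λ w → - cond (Q? w) (b w)) ⟩
      sumOver a + sum (λ w → - cond (Q? w) (b w))
        ≈⟨ +-congˡ (sum-neg (λ w → cond (Q? w) (b w))) ⟩
      sumOver a - sumOver b ∎

    sumOver-⊛ : ∀ k a → sumOver (k ⊛ a) ≈ k * sumOver a
    sumOver-⊛ k a = trans (sum-cong-≋ λ w → cond-*ˡ (Q? w) k (a w))
                          (sym (*-distribˡ-sum k (λ w → cond (Q? w) (a w))))

    sumOver-∑ᵥ : ∀ {m} (g : Fin m → kS) → sumOver (∑ᵥ g) ≈ sum (λ i → sumOver (g i))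
    sumOver-∑ᵥ g = begin
      sum (λ w → cond (Q? w) (∑ (λ i → g i w)))
        ≡⟨ sum-cong-≗ (λ w → ≡.cong (cond (Q? w)) (∑≡sum (λ i → g i w))) ⟩
      sum (λ w → cond (Q? w) (sum (λ i → g i w)))
        ≈⟨ sum-cong-≋ (λ w → cond-sum (Q? w) (λ i → g i w)) ⟩
      sum (λ w → sum (λ i → cond (Q? w) (g i w)))
        ≈⟨ ∑-comm (λ w i → cond (Q? w) (g i w)) ⟩
      sum (λ i → sumOver (g i)) ∎

    sumOver-∑ᵥ[] : ∀ {m} {P : Fin m → Set} (P? : ∀ i → Dec (P i)) (g : Fin m → kS) →
                   sumOver ∑ᵥ[ P? ∣ g ] ≈ sum (λ i → cond (P? i) (sumOver (g i)))
    sumOver-∑ᵥ[] P? g = begin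
      sum (λ w → cond (Q? w) ∑[ P? ∣ (λ i → g i w) ])
        ≈⟨ sum-cong-≋ (λ w → trans (cond-cong (Q? w) (∑[]≈sum P? (λ i → g i w)))
                                   (cond-sum (Q? w) (λ i → cond (P? i) (g i w)))) ⟩
      sum (λ w → sum (λ i → cond (Q? w) (cond (P? i) (g i w))))
        ≈⟨ ∑-comm (λ w i → cond (Q? w) (cond (P? i) (g i w))) ⟩
      sum (λ i → sum (λ w → cond (Q? w) (cond (P? i) (g i w))))
        ≈⟨ sum-cong-≋ (λ i → sum-cong-≋ (λ w → cond-comm (Q? w) (P? i) _)) ⟩
      sum (λ i → sum (λ w → cond (P? i) (cond (Q? w) (g i w))))
        ≈⟨ sum-cong-≋ (λ i → cond-sum (P? i) (λ w → cond (Q? w) (g i w))) ⟨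
      sum (λ i → cond (P? i) (sumOver (g i))) ∎

    sumOver-δ : ∀ t → sumOver (δ t) ≈ cond (Q? t) 1#
    sumOver-δ t =
      trans (sum-single t λ w w≢t → cond-zeroᵈ (Q? w) λ _ → δ-≢ (λ t≡w → w≢t (≡.sym t≡w)))
            (cond-cong (Q? t) (δ-self t))

  sumOver-⇔ : ∀ {P Q : Fin n → Set} (P? : ∀ w → Dec (P w)) (Q? : ∀ w → Dec (Q w)) →
              (∀ {w} → P w → Q w) → (∀ {w} → Q w → P w) → ∀ a → sumOver P? a ≈ sumOver Q? a
  sumOver-⇔ P? Q? P⇒Q Q⇒P a = sum-cong-≋ λ w → cond-⇔ (P? w) (Q? w) P⇒Q Q⇒P

  ∑ᵥ[]-congᵈ : ∀ {m} {P : Fin m → Set} (P? : ∀ i → Dec (P i)) {f g : Fin m → kS} →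
               (∀ i → P i → f i ≋ g i) → ∑ᵥ[ P? ∣ f ] ≋ ∑ᵥ[ P? ∣ g ]
  ∑ᵥ[]-congᵈ P? {f} {g} f≋g z = begin
    ∑[ P? ∣ (λ i → f i z) ]                ≈⟨ ∑[]≈sum P? (λ i → f i z) ⟩
    sum (λ i → cond (P? i) (f i z))        ≈⟨ sum-cong-≋ (λ i → cond-congᵈ (P? i) λ p → f≋g i p z) ⟩
    sum (λ i → cond (P? i) (g i z))        ≈⟨ ∑[]≈sum P? (λ i → g i z) ⟨
    ∑[ P? ∣ (λ i → g i z) ]                ∎

  δ-apply : ∀ t z → δ t z ≈ cond (t ≟ z) 1#
  δ-apply t z with t ≟ z
  ... | yes _ = refl
  ... | no _  = refl

  ⊗-apply : ∀ a b z → (a ⊗ b) z ≈ sum (λ s → a s * sumOver (λ w → s · w ≟ z) b)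
  ⊗-apply a b z = begin
    ∑ (λ s → ∑[ (λ w → s · w ≟ z) ∣ (λ w → a s * b w) ])
      ≡⟨ ∑≡sum (λ s → ∑[ (λ w → s · w ≟ z) ∣ (λ w → a s * b w) ]) ⟩
    sum (λ s → ∑[ (λ w → s · w ≟ z) ∣ (λ w → a s * b w) ])
      ≈⟨ sum-cong-≋ (λ s → ∑[]≈sum (λ w → s · w ≟ z) (λ w → a s * b w)) ⟩
    sum (λ s → sum (λ w → cond (s · w ≟ z) (a s * b w)))
      ≈⟨ sum-cong-≋ (λ s → sum-cong-≋ (λ w → cond-*ˡ (s · w ≟ z) (a s) (b w))) ⟩
    sum (λ s → sum (λ w → a s * cond (s · w ≟ z) (b w)))
      ≈⟨ sum-cong-≋ (λ s → *-distribˡ-sum (a s) (λ w → cond (s · w ≟ z) (b w))) ⟨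
    sum (λ s → a s * sumOver (λ w → s · w ≟ z) b) ∎

  δ⊗-apply : ∀ t a z → (δ t ⊗ a) z ≈ sumOver (λ w → t · w ≟ z) a
  δ⊗-apply t a z = begin
    (δ t ⊗ a) z
      ≈⟨ ⊗-apply (δ t) a z ⟩
    sum (λ s → δ t s * sumOver (λ w → s · w ≟ z) a)
      ≈⟨ sum-single t (λ s s≢t → trans (*-congʳ (δ-≢ (λ t≡s → s≢t (≡.sym t≡s)))) (zeroˡ _)) ⟩
    δ t t * sumOver (λ w → t · w ≟ z) a
      ≈⟨ *-congʳ (δ-self t) ⟩
    1# * sumOver (λ w → t · w ≟ z) a
      ≈⟨ *-identityˡ _ ⟩
    sumOver (λ w → t · w ≟ z) a ∎

  ⊗-expand : ∀ a b → a ⊗ b ≋ ∑ᵥ (λ s → a s ⊛ (δ s ⊗ b))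
  ⊗-expand a b z = begin
    (a ⊗ b) z                                      ≈⟨ ⊗-apply a b z ⟩
    sum (λ s → a s * sumOver (λ w → s · w ≟ z) b)  ≈⟨ sum-cong-≋ (λ s → *-congˡ (δ⊗-apply s b z)) ⟨
    sum (λ s → a s * (δ s ⊗ b) z)                  ≡⟨ ∑≡sum (λ s → a s * (δ s ⊗ b) z) ⟨
    ∑ (λ s → a s * (δ s ⊗ b) z)                    ∎

  sumOver-δ⊗ : ∀ {Q : Fin n → Set} (Q? : ∀ w → Dec (Q w)) s a →
               sumOver Q? (δ s ⊗ a) ≈ sumOver (λ w → Q? (s · w)) a
  sumOver-δ⊗ Q? s a = begin
    sum (λ z → cond (Q? z) ((δ s ⊗ a) z))
      ≈⟨ sum-cong-≋ (λ z → cond-cong (Q? z) (δ⊗-apply s a z)) ⟩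
    sum (λ z → cond (Q? z) (sum (λ w → cond (s · w ≟ z) (a w))))
      ≈⟨ sum-cong-≋ (λ z → cond-sum (Q? z) (λ w → cond (s · w ≟ z) (a w))) ⟩
    sum (λ z → sum (λ w → cond (Q? z) (cond (s · w ≟ z) (a w))))
      ≈⟨ ∑-comm (λ z w → cond (Q? z) (cond (s · w ≟ z) (a w))) ⟩
    sum (λ w → sum (λ z → cond (Q? z) (cond (s · w ≟ z) (a w))))
      ≈⟨ sum-cong-≋ collapse ⟩
    sum (λ w → cond (Q? (s · w)) (a w)) ∎
    where
      collapse : ∀ w → sum (λ z → cond (Q? z) (cond (s · w ≟ z) (a w))) ≈ cond (Q? (s · w)) (a w)
      collapse w = trans (sum-cong-≋ λ z → cond-comm (Q? z) (s · w ≟ z) (a w))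
                         (sum-cond-≡ (λ z → cond (Q? z) (a w)) (s · w))

  δ⊗-congᵈ : ∀ t {a b} z → (∀ w → t · w ≡ z → a w ≈ b w) → (δ t ⊗ a) z ≈ (δ t ⊗ b) z
  δ⊗-congᵈ t {a} {b} z a≈b =
    trans (δ⊗-apply t a z) (trans (sumOver-congᵈ (λ w → t · w ≟ z) a≈b) (sym (δ⊗-apply t b z)))

  δ⊗-cong : ∀ t {a b} → a ≋ b → δ t ⊗ a ≋ δ t ⊗ b
  δ⊗-cong t a≋b z = δ⊗-congᵈ t z λ w _ → a≋b w

  δ⊗-vanish : ∀ t {a} z → (∀ w → t · w ≡ z → a w ≈ 0#) → (δ t ⊗ a) z ≈ 0#
  δ⊗-vanish t {a} z a≈0 = trans (δ⊗-apply t a z) (sum-zero λ w → cond-zeroᵈ (t · w ≟ z) (a≈0 w))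

  δ⊗-support : ∀ {t z} a → ¬ (t ⪯ z) → (δ t ⊗ a) z ≈ 0#
  δ⊗-support {t} {z} a t⋠z =
    δ⊗-vanish t z λ w t·w≡z → ⊥-elim (t⋠z (≡.subst (t ⪯_) t·w≡z (x⪯x·y t w)))

  δ⊗-support-≺ : ∀ {t z} a → t ≢ z → ¬ (t ≺ z) → (δ t ⊗ a) z ≈ 0#
  δ⊗-support-≺ {t} {z} a t≢z t⊀z = δ⊗-vanish t z λ w t·w≡z →
    let t⪯z = ≡.subst (t ⪯_) t·w≡z (x⪯x·y t w)
        z⋠t = λ z⪯t →
          t≢z (≡.trans (≡.sym (x·y⪯x⇒x·y≡x (≡.subst (_⪯ t) (≡.sym t·w≡z) z⪯t))) t·w≡z)
    in ⊥-elim (t⊀z (t⪯z , z⋠t))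

  δ⊗-δ : ∀ s t → δ s ⊗ δ t ≋ δ (s · t)
  δ⊗-δ s t z = begin
    (δ s ⊗ δ t) z                    ≈⟨ δ⊗-apply s (δ t) z ⟩
    sumOver (λ w → s · w ≟ z) (δ t)  ≈⟨ sumOver-δ (λ w → s · w ≟ z) t ⟩
    cond (s · t ≟ z) 1#              ≈⟨ δ-apply (s · t) z ⟨
    δ (s · t) z                      ∎

  δ⊗-δ⊗ : ∀ s t a → δ s ⊗ (δ t ⊗ a) ≋ δ (s · t) ⊗ a
  δ⊗-δ⊗ s t a z = begin
    (δ s ⊗ (δ t ⊗ a)) z                     ≈⟨ δ⊗-apply s (δ t ⊗ a) z ⟩
    sumOver (λ w → s · w ≟ z) (δ t ⊗ a)     ≈⟨ sumOver-δ⊗ (λ w → s · w ≟ z) t a ⟩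
    sumOver (λ w → s · (t · w) ≟ z) a       ≈⟨ sumOver-⇔ (λ w → s · (t · w) ≟ z) (λ w → s · t · w ≟ z)
                                                 (≡.trans (assoc s t _)) (≡.trans (≡.sym (assoc s t _))) a ⟩
    sumOver (λ w → s · t · w ≟ z) a         ≈⟨ δ⊗-apply (s · t) a z ⟨
    (δ (s · t) ⊗ a) z                       ∎

  δ⊗-⊖ : ∀ t a b → δ t ⊗ (a ⊖ b) ≋ (δ t ⊗ a) ⊖ (δ t ⊗ b)
  δ⊗-⊖ t a b z = begin
    (δ t ⊗ (a ⊖ b)) z
      ≈⟨ δ⊗-apply t (a ⊖ b) z ⟩
    sumOver (λ w → t · w ≟ z) (a ⊖ b)
      ≈⟨ sumOver-⊖ (λ w → t · w ≟ z) a b ⟩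
    sumOver (λ w → t · w ≟ z) a - sumOver (λ w → t · w ≟ z) b
      ≈⟨ +-cong (δ⊗-apply t a z) (-‿cong (δ⊗-apply t b z)) ⟨
    (δ t ⊗ a) z - (δ t ⊗ b) z ∎

  δ⊗-∑ᵥ[] : ∀ t {m} {P : Fin m → Set} (P? : ∀ i → Dec (P i)) g →
            δ t ⊗ ∑ᵥ[ P? ∣ g ] ≋ ∑ᵥ[ P? ∣ (λ i → δ t ⊗ g i) ]
  δ⊗-∑ᵥ[] t P? g z = begin
    (δ t ⊗ ∑ᵥ[ P? ∣ g ]) z
      ≈⟨ δ⊗-apply t _ z ⟩
    sumOver (λ w → t · w ≟ z) ∑ᵥ[ P? ∣ g ]
      ≈⟨ sumOver-∑ᵥ[] (λ w → t · w ≟ z) P? g ⟩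
    sum (λ i → cond (P? i) (sumOver (λ w → t · w ≟ z) (g i)))
      ≈⟨ sum-cong-≋ (λ i → cond-cong (P? i) (δ⊗-apply t (g i) z)) ⟨
    sum (λ i → cond (P? i) ((δ t ⊗ g i) z))
      ≈⟨ ∑[]≈sum P? (λ i → (δ t ⊗ g i) z) ⟨
    ∑ᵥ[ P? ∣ (λ i → δ t ⊗ g i) ] z ∎

  χ : Fin n → kS → Carrier
  χ y = sumOver (_⪯? y)

  χ-δ⊗ : ∀ y s a → χ y (δ s ⊗ a) ≈ cond (s ⪯? y) (χ y a)
  χ-δ⊗ y s a = begin
    χ y (δ s ⊗ a)
      ≈⟨ sumOver-δ⊗ (_⪯? y) s a ⟩
    sum (λ w → cond (s · w ⪯? y) (a w))
      ≈⟨ sum-cong-≋ (λ w → cond-× (s ⪯? y) (w ⪯? y) (s · w ⪯? y)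
                              (⪯-trans (x⪯x·y s w)) (⪯-trans (y⪯x·y s w)) ·-lub) ⟩
    sum (λ w → cond (s ⪯? y) (cond (w ⪯? y) (a w)))
      ≈⟨ cond-sum (s ⪯? y) (λ w → cond (w ⪯? y) (a w)) ⟨
    cond (s ⪯? y) (χ y a) ∎

  χ-⊗ : ∀ y a b → χ y (a ⊗ b) ≈ χ y a * χ y b
  χ-⊗ y a b = begin
    χ y (a ⊗ b)
      ≈⟨ sumOver-cong (_⪯? y) (⊗-expand a b) ⟩
    χ y (∑ᵥ (λ s → a s ⊛ (δ s ⊗ b)))
      ≈⟨ sumOver-∑ᵥ (_⪯? y) (λ s → a s ⊛ (δ s ⊗ b)) ⟩
    sum (λ s → χ y (a s ⊛ (δ s ⊗ b)))
      ≈⟨ sum-cong-≋ (λ s → trans (sumOver-⊛ (_⪯? y) (a s) (δ s ⊗ b)) (*-congˡ (χ-δ⊗ y s b))) ⟩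
    sum (λ s → a s * cond (s ⪯? y) (χ y b))
      ≈⟨ sum-cong-≋ (λ s → trans (sym (cond-*ˡ (s ⪯? y) (a s) (χ y b)))
                                 (cond-*ʳ (s ⪯? y) (a s) (χ y b))) ⟩
    sum (λ s → cond (s ⪯? y) (a s) * χ y b)
      ≈⟨ *-distribʳ-sum (χ y b) (λ s → cond (s ⪯? y) (a s)) ⟨
    χ y a * χ y b ∎

  χ-cong-∼ : ∀ {x y} → x ∼ y → ∀ a → χ x a ≈ χ y a
  χ-cong-∼ (x⪯y , y⪯x) =
    sumOver-⇔ (_⪯? _) (_⪯? _) (λ w⪯x → ⪯-trans w⪯x x⪯y) (λ w⪯y → ⪯-trans w⪯y y⪯x)

  χ-idempotent : ∀ y {p} → IsIdempotent p → χ y p * χ y p ≈ χ y p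
  χ-idempotent y {p} p-idem = trans (sym (χ-⊗ y p p)) (sumOver-cong (_⪯? y) p-idem)

  χ-orthogonal : ∀ y {p q} → p ⊗ q ≋ 𝟘 → χ y p * χ y q ≈ 0#
  χ-orthogonal y {p} {q} p⊗q≋𝟘 = trans (sym (χ-⊗ y p q)) (sumOver-𝟘 (_⪯? y) p⊗q≋𝟘)

  idempotent-χ≈0⇒𝟘 : ∀ {h} → IsIdempotent h → (∀ y → χ y h ≈ 0#) → h ≋ 𝟘
  idempotent-χ≈0⇒𝟘 {h} h-idem χh≈0 = All.wfRec ≺-wellFounded ℓ (λ z → h z ≈ 0#) step
    where
      step : ∀ z → (∀ {s} → s ≺ z → h s ≈ 0#) → h z ≈ 0#
      step z below≈0 = begin
        h z                               ≈⟨ h-idem z ⟨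
        (h ⊗ h) z                         ≈⟨ ⊗-expand h h z ⟩
        ∑ (λ s → h s * (δ s ⊗ h) z)       ≡⟨ ∑≡sum (λ s → h s * (δ s ⊗ h) z) ⟩
        sum (λ s → h s * (δ s ⊗ h) z)     ≈⟨ sum-single z off-diagonal ⟩
        h z * (δ z ⊗ h) z                 ≈⟨ *-congˡ (trans (δ⊗-apply z h z) (χh≈0 z)) ⟩
        h z * 0#                          ≈⟨ zeroʳ (h z) ⟩
        0#                                ∎
        where
          off-diagonal : ∀ s → s ≢ z → h s * (δ s ⊗ h) z ≈ 0#
          off-diagonal s s≢z with s ≺? z
          ... | yes s≺z = trans (*-congʳ (below≈0 s≺z)) (zeroˡ _)
          ... | no s⊀z  = trans (*-congˡ (δ⊗-support-≺ h s≢z s⊀z)) (zeroʳ _)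

  idempotent-χ≈0-off-class⇒𝟘 : ∀ {p} x → IsIdempotent p →
                               (∀ y → ¬ (x ∼ y) → χ y p ≈ 0#) → χ x p ≈ 0# → p ≋ 𝟘
  idempotent-χ≈0-off-class⇒𝟘 {p} x p-idem off-class χxp≈0 = idempotent-χ≈0⇒𝟘 p-idem χ≈0
    where
      χ≈0 : ∀ y → χ y p ≈ 0#
      χ≈0 y with (x ⪯? y) ×-dec (y ⪯? x)
      ... | yes x∼y = trans (sym (χ-cong-∼ x∼y p)) χxp≈0
      ... | no x≁y  = off-class y x≁y

  module Span (b : Fin n → kS) where

    Spanned : kS → Set (c ⊔ ℓ)
    Spanned v = Σ (Fin n → Carrier) λ λs → v ≋ ∑ᵥ (λ i → λs i ⊛ b i)

    spanned-cong : ∀ {v w} → v ≋ w → Spanned v → Spanned w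
    spanned-cong v≋w (λs , v≋) = λs , λ z → trans (sym (v≋w z)) (v≋ z)

    spanned-𝟘 : Spanned 𝟘
    spanned-𝟘 = (λ _ → 0#) , λ z → sym (begin
      ∑ (λ i → 0# * b i z)    ≡⟨ ∑≡sum (λ i → 0# * b i z) ⟩
      sum (λ i → 0# * b i z)  ≈⟨ sum-zero (λ i → zeroˡ (b i z)) ⟩
      0#                      ∎)

    spanned-⊕ : ∀ {v w} → Spanned v → Spanned w → Spanned (v ⊕ w)
    spanned-⊕ {v} {w} (λs , v≋) (μs , w≋) = (λ i → λs i + μs i) , λ z → begin
      v z + w z
        ≈⟨ +-cong (v≋ z) (w≋ z) ⟩
      ∑ (λ i → λs i * b i z) + ∑ (λ i → μs i * b i z)
        ≡⟨ ≡.cong₂ _+_ (∑≡sum (λ i → λs i * b i z)) (∑≡sum (λ i → μs i * b i z)) ⟩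
      sum (λ i → λs i * b i z) + sum (λ i → μs i * b i z)
        ≈⟨ ∑-distrib-+ (λ i → λs i * b i z) (λ i → μs i * b i z) ⟨
      sum (λ i → λs i * b i z + μs i * b i z)
        ≈⟨ sum-cong-≋ (λ i → distribʳ (b i z) (λs i) (μs i)) ⟨
      sum (λ i → (λs i + μs i) * b i z)
        ≡⟨ ∑≡sum (λ i → (λs i + μs i) * b i z) ⟨
      ∑ (λ i → (λs i + μs i) * b i z) ∎

    spanned-⊛ : ∀ k {v} → Spanned v → Spanned (k ⊛ v)
    spanned-⊛ k {v} (λs , v≋) = (λ i → k * λs i) , λ z → begin
      k * v z                                ≈⟨ *-congˡ (v≋ z) ⟩
      k * ∑ (λ i → λs i * b i z)             ≡⟨ ≡.cong (k *_) (∑≡sum (λ i → λs i * b i z)) ⟩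
      k * sum (λ i → λs i * b i z)           ≈⟨ *-distribˡ-sum k (λ i → λs i * b i z) ⟩
      sum (λ i → k * (λs i * b i z))         ≈⟨ sum-cong-≋ (λ i → *-assoc k (λs i) (b i z)) ⟨
      sum (λ i → k * λs i * b i z)           ≡⟨ ∑≡sum (λ i → k * λs i * b i z) ⟨
      ∑ (λ i → k * λs i * b i z)             ∎

    spanned-∑ᵥ : ∀ {m} (g : Fin m → kS) → (∀ i → Spanned (g i)) → Spanned (∑ᵥ g)
    spanned-∑ᵥ {zero}  g _       = spanned-𝟘
    spanned-∑ᵥ {suc m} g spanned =
      spanned-⊕ (spanned zero) (spanned-∑ᵥ (λ i → g (suc i)) (λ i → spanned (suc i)))

    spanned-member : ∀ x → Spanned (b x)
    spanned-member x = δ x , λ z → sym (begin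
      ∑ (λ i → δ x i * b i z)
        ≡⟨ ∑≡sum (λ i → δ x i * b i z) ⟩
      sum (λ i → δ x i * b i z)
        ≈⟨ sum-single x (λ i i≢x → trans (*-congʳ (δ-≢ (λ x≡i → i≢x (≡.sym x≡i)))) (zeroˡ _)) ⟩
      δ x x * b x z
        ≈⟨ *-congʳ (δ-self x) ⟩
      1# * b x z
        ≈⟨ *-identityˡ (b x z) ⟩
      b x z ∎)

  IsUnitriangular : (Fin n → kS) → Set ℓ
  IsUnitriangular b = ∀ x z → ¬ (x ≺ z) → b x z ≈ δ x z

  module _ {b : Fin n → kS} (b-unitriangular : IsUnitriangular b) where
    open Span b

    unitriangular⇒independent : ∀ (λs : Fin n → Carrier) →
                                ∑ᵥ (λ i → λs i ⊛ b i) ≋ 𝟘 → ∀ i → λs i ≈ 0#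
    unitriangular⇒independent λs ∑≋𝟘 = All.wfRec ≺-wellFounded ℓ (λ x → λs x ≈ 0#) step
      where
        step : ∀ x → (∀ {j} → j ≺ x → λs j ≈ 0#) → λs x ≈ 0#
        step x below≈0 = begin
          λs x                          ≈⟨ *-identityʳ (λs x) ⟨
          λs x * 1#                     ≈⟨ *-congˡ (trans (b-unitriangular x x ≺-irrefl) (δ-self x)) ⟨
          λs x * b x x                  ≈⟨ sum-single x off-diagonal ⟨
          sum (λ j → λs j * b j x)      ≡⟨ ∑≡sum (λ j → λs j * b j x) ⟨
          ∑ (λ j → λs j * b j x)        ≈⟨ ∑≋𝟘 x ⟩
          0#                            ∎
          where
            off-diagonal : ∀ j → j ≢ x → λs j * b j x ≈ 0#
            off-diagonal j j≢x with j ≺? x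
            ... | yes j≺x = trans (*-congʳ (below≈0 j≺x)) (zeroˡ _)
            ... | no j⊀x  = trans (*-congˡ (trans (b-unitriangular j x j⊀x) (δ-≢ j≢x))) (zeroʳ _)

    unitriangular⇒spanning : ∀ v → Spanned v
    unitriangular⇒spanning v =
      spanned-cong (δ-expand v) (spanned-∑ᵥ (λ s → v s ⊛ δ s) λ s → spanned-⊛ (v s) (spanned-δ s))
      where
        spanned-δ : ∀ s → Spanned (δ s)
        spanned-δ = All.wfRec ≻-wellFounded (c ⊔ ℓ) (λ s → Spanned (δ s)) step
          where
            step : ∀ s → (∀ {z} → s ≺ z → Spanned (δ z)) → Spanned (δ s)
            step s above-spanned = spanned-cong δ≋b+error
              (spanned-⊕ (spanned-member s) (spanned-∑ᵥ (λ z → error z ⊛ δ z) spanned-term))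
              where
                error : Fin n → Carrier
                error z = δ s z - b s z
                δ≋b+error : b s ⊕ ∑ᵥ (λ z → error z ⊛ δ z) ≋ δ s
                δ≋b+error w = trans (+-congˡ (δ-expand error w))
                                    (trans (+-comm (b s w) (error w)) (//-rightDividesˡ (b s w) (δ s w)))
                spanned-term : ∀ z → Spanned (error z ⊛ δ z)
                spanned-term z with s ≺? z
                ... | yes s≺z = spanned-⊛ (error z) (above-spanned s≺z)
                ... | no s⊀z  = spanned-cong (λ w → sym (trans (*-congʳ error≈0) (zeroˡ (δ z w)))) spanned-𝟘
                  where error≈0 = x≈y⇒x∙y⁻¹≈ε (sym (b-unitriangular s z s⊀z))

    unitriangular⇒basis : IsBasis b
    unitriangular⇒basis = unitriangular⇒independent , unitriangular⇒spanning

module PrimitiveIdempotents {c ℓ : Level} (K : Field c ℓ) {n : ℕ} (S : LRBWithIdentity n)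
                            (R : Representatives S) where
  open Field K hiding (zero)
  open LRBWithIdentity S renaming (_·_ to infixl 30 _·_)
  open SemigroupAlgebra K S
    renaming ( _⊗_ to infixl 7 _⊗_; _⊛_ to infixr 7 _⊛_; _⊕_ to infixl 6 _⊕_; _⊖_ to infixl 6 _⊖_
             ; _≋_ to infix 4 _≋_)
  open Representatives R
  open LeftRegularBandOrder S
  open FieldSums K
  open SemigroupAlgebraProperties K S
  open import Algebra.Properties.Semiring.Sum semiring
  open import Algebra.Properties.AbelianGroup +-abelianGroup using (//-rightDividesˡ; x≈y⇒x∙y⁻¹≈ε)
  open import Algebra.Properties.Ring ring using (-0#≈0#)
  open import Relation.Binary.Reasoning.Setoid setoid

  rep⪯ : ∀ x → rep x ⪯ x
  rep⪯ x = proj₁ (rep-∼ x)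

  ⪯rep : ∀ x → x ⪯ rep x
  ⪯rep x = proj₂ (rep-∼ x)

  rep-idem : ∀ x → rep (rep x) ≡ rep x
  rep-idem x = rep-cong (rep x) x (rep-∼ x)

  RepAbove : Fin n → Fin n → Set
  RepAbove r y = rep y ≡ y × r ≺ y

  repAbove? : ∀ r y → Dec (RepAbove r y)
  repAbove? r y = (rep y ≟ y) ×-dec (r ≺? y)

  #above-repAbove : ∀ {r y} → RepAbove r y → #above (rep y) < #above r
  #above-repAbove {r} (rep-y≡y , r≺y) =
    ≡.subst (λ u → #above u < #above r) (≡.sym rep-y≡y) (#above-≺ r≺y)

  eFuel-irrelevant : ∀ {j k} x → #above (rep x) < j → #above (rep x) < k → eFuel R j x ≋ eFuel R k x
  eFuel-irrelevant {suc j} {suc k} x (s≤s r≤j) (s≤s r≤k) w =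
    +-congˡ (-‿cong (∑ᵥ[]-congᵈ (repAbove? (rep x))
      (λ y y-above → δ⊗-cong (rep x) (eFuel-irrelevant y (<-≤-trans (#above-repAbove y-above) r≤j)
                                                       (<-≤-trans (#above-repAbove y-above) r≤k))) w))

  e : Fin n → kS
  e = eOf R

  -- Fuel n already exceeds every #above, so fuel n and fuel n + 1 agree, and the
  -- latter unfolds to the defining recursion.
  e-unfold : ∀ x → e x ≋ δ (rep x) ⊖ ∑ᵥ[ repAbove? (rep x) ∣ (λ y → δ (rep x) ⊗ e y) ]
  e-unfold x = eFuel-irrelevant x (#above<n (rep x)) (m<n⇒m<1+n (#above<n (rep x)))

  e-apply : ∀ x w → e x w ≈ δ (rep x) w - sum (λ y → cond (repAbove? (rep x) y) ((δ (rep x) ⊗ e y) w))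
  e-apply x w =
    trans (e-unfold x w) (+-congˡ (-‿cong (∑[]≈sum (repAbove? (rep x)) (λ y → (δ (rep x) ⊗ e y) w))))

  δ⊗e-apply : ∀ s x {u} → s · rep x ≡ u → ∀ z →
              (δ s ⊗ e x) z ≈ δ u z - sum (λ y → cond (repAbove? (rep x) y) ((δ u ⊗ e y) z))
  δ⊗e-apply s x ≡.refl z = begin
    (δ s ⊗ e x) z
      ≈⟨ δ⊗-cong s (e-unfold x) z ⟩
    (δ s ⊗ (δ r ⊖ ∑ᵥ[ P? ∣ (λ y → δ r ⊗ e y) ])) z
      ≈⟨ δ⊗-⊖ s (δ r) _ z ⟩
    (δ s ⊗ δ r) z - (δ s ⊗ ∑ᵥ[ P? ∣ (λ y → δ r ⊗ e y) ]) z
      ≈⟨ +-cong (δ⊗-δ s r z) (-‿cong (δ⊗-∑ᵥ[] s P? (λ y → δ r ⊗ e y) z)) ⟩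
    δ (s · r) z - ∑[ P? ∣ (λ y → (δ s ⊗ (δ r ⊗ e y)) z) ]
      ≈⟨ +-congˡ (-‿cong (∑ᵥ[]-congᵈ P? (λ y _ → δ⊗-δ⊗ s r (e y)) z)) ⟩
    δ (s · r) z - ∑[ P? ∣ (λ y → (δ (s · r) ⊗ e y) z) ]
      ≈⟨ +-congˡ (-‿cong (∑[]≈sum P? (λ y → (δ (s · r) ⊗ e y) z))) ⟩
    δ (s · r) z - sum (λ y → cond (P? y) ((δ (s · r) ⊗ e y) z)) ∎
    where
      r = rep x
      P? = repAbove? r

  e-support : ∀ x {w} → ¬ (rep x ⪯ w) → e x w ≈ 0#
  e-support x {w} r⋠w = trans (e-apply x w) (x≈y⇒x∙y⁻¹≈ε (trans δ≈0 (sym ∑≈0)))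
    where
      r = rep x
      δ≈0 : δ r w ≈ 0#
      δ≈0 = δ-≢ λ r≡w → r⋠w (≡.subst (r ⪯_) r≡w (⪯-refl r))
      ∑≈0 : sum (λ y → cond (repAbove? r y) ((δ r ⊗ e y) w)) ≈ 0#
      ∑≈0 = sum-zero λ y → cond-zeroᵈ (repAbove? r y) λ _ → δ⊗-support (e y) r⋠w

  e-below : ∀ x {w} → w ⪯ rep x → e x w ≈ δ (rep x) w
  e-below x {w} w⪯r = begin
    e x w
      ≈⟨ e-apply x w ⟩
    δ r w - sum (λ y → cond (repAbove? r y) ((δ r ⊗ e y) w))
      ≈⟨ +-congˡ (-‿cong (sum-zero λ y → cond-zeroᵈ (repAbove? r y) (term≈0 y))) ⟩
    δ r w - 0#
      ≈⟨ +-congˡ -0#≈0# ⟩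
    δ r w + 0#
      ≈⟨ +-identityʳ (δ r w) ⟩
    δ r w ∎
    where
      r = rep x
      term≈0 : ∀ y → RepAbove r y → (δ r ⊗ e y) w ≈ 0#
      term≈0 y (rep-y≡y , (_ , y⋠r)) = δ⊗-vanish r w λ v r·v≡w → e-support y λ rep-y⪯v →
        y⋠r (⪯-trans (≡.subst (_⪯ v) rep-y≡y rep-y⪯v)
                     (⪯-trans (≡.subst (v ⪯_) r·v≡w (y⪯x·y r v)) w⪯r))

  δ⊗e≋𝟘 : ∀ x s → ¬ (s ⪯ rep x) → δ s ⊗ e x ≋ 𝟘
  δ⊗e≋𝟘 = All.wfRec ≻-wellFounded ℓ (λ x → ∀ s → ¬ (s ⪯ rep x) → δ s ⊗ e x ≋ 𝟘) step
    where
      step : ∀ x → (∀ {y} → x ≺ y → ∀ s → ¬ (s ⪯ rep y) → δ s ⊗ e y ≋ 𝟘) →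
             ∀ s → ¬ (s ⪯ rep x) → δ s ⊗ e x ≋ 𝟘
      step x above s s⋠r z = begin
        (δ s ⊗ e x) z       ≈⟨ δ⊗e-apply s x ≡.refl z ⟩
        A - B               ≈⟨ +-congˡ (-‿cong B≈A) ⟩
        A - A               ≈⟨ x≈y⇒x∙y⁻¹≈ε refl ⟩
        0#                  ∎
        where
          -- B splits at the representative t̂ of supp t: X t̂ = A − C, the
          -- representatives above t̂′ contribute C, and the rest vanish by induction.
          r  = rep x
          t  = s · r
          t̂  = rep t
          t̂′ = rep t̂
          X : Fin n → Carrier
          X y = (δ t ⊗ e y) z
          A = δ t z
          B = sum (λ y → cond (repAbove? r y) (X y))
          C = sum (λ y → cond (repAbove? t̂′ y) (X y))
          r≺t : r ≺ t
          r≺t = y⪯x·y s r , λ t⪯r → s⋠r (⪯-trans (x⪯x·y s r) t⪯r)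
          t⪯t̂′ : t ⪯ t̂′
          t⪯t̂′ = ⪯-trans (⪯rep t) (⪯rep t̂)
          t̂′⪯t : t̂′ ⪯ t
          t̂′⪯t = ⪯-trans (rep⪯ t̂) (rep⪯ t)
          X-t̂ : X t̂ ≈ A - C
          X-t̂ = δ⊗e-apply t t̂ t̂′⪯t z
          t̂-above : RepAbove r t̂
          t̂-above = rep-idem t , ≺-⪯-trans r≺t (⪯rep t)
          t̂-not-above : ¬ RepAbove t̂′ t̂
          t̂-not-above (_ , (_ , t̂⋠t̂′)) = t̂⋠t̂′ (⪯rep t̂)
          above-t̂′⇒above-r : ∀ {y} → RepAbove t̂′ y → RepAbove r y
          above-t̂′⇒above-r (rep-y≡y , t̂′≺y) = rep-y≡y , ≺-trans (≺-⪯-trans r≺t t⪯t̂′) t̂′≺y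
          X≈0 : ∀ y → RepAbove r y → y ≢ t̂ → ¬ RepAbove t̂′ y → X y ≈ 0#
          X≈0 y (rep-y≡y , r≺y) y≢t̂ y-not-above = above (⪯-≺-trans (⪯rep x) r≺y) t t⋠rep-y z
            where
              t⋠rep-y : ¬ (t ⪯ rep y)
              t⋠rep-y t⪯rep-y = y-not-above (rep-y≡y , ⪯-trans t̂′⪯t t⪯y , λ y⪯t̂′ →
                y≢t̂ (≡.trans (≡.sym rep-y≡y) (rep-cong y t (⪯-trans y⪯t̂′ t̂′⪯t , t⪯y))))
                where t⪯y = ≡.subst (t ⪯_) rep-y≡y t⪯rep-y
          B≈A : B ≈ A
          B≈A = begin
            B
              ≈⟨ sum-cond-split (repAbove? r) (repAbove? t̂′) X t̂
                                t̂-above t̂-not-above above-t̂′⇒above-r X≈0 ⟩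
            X t̂ + C
              ≈⟨ +-congʳ X-t̂ ⟩
            A - C + C
              ≈⟨ //-rightDividesˡ C A ⟩
            A ∎

  b : Fin n → kS
  b x = δ x ⊗ e x

  b-below : ∀ {x z} → z ⪯ x → b x z ≈ δ x z
  b-below {x} {z} z⪯x = begin
    (δ x ⊗ e x) z        ≈⟨ δ⊗-congᵈ x z (λ w x·w≡z → e-below x (w⪯r w x·w≡z)) ⟩
    (δ x ⊗ δ (rep x)) z  ≈⟨ δ⊗-δ x (rep x) z ⟩
    δ (x · rep x) z      ≡⟨ ≡.cong (λ u → δ u z) (rep⪯ x) ⟩
    δ x z                ∎
    where
      w⪯r : ∀ w → x · w ≡ z → w ⪯ rep x
      w⪯r w x·w≡z = ⪯-trans (≡.subst (w ⪯_) x·w≡z (y⪯x·y x w)) (⪯-trans z⪯x (⪯rep x))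

  b-unitriangular : IsUnitriangular b
  b-unitriangular x z x⊀z with x ⪯? z
  ... | no x⋠z =
    trans (δ⊗-support (e x) x⋠z) (sym (δ-≢ λ x≡z → x⋠z (≡.subst (x ⪯_) x≡z (⪯-refl x))))
  ... | yes x⪯z with z ⪯? x
  ...   | yes z⪯x = b-below z⪯x
  ...   | no z⋠x  = ⊥-elim (x⊀z (x⪯z , z⋠x))

  b-self : ∀ x → b x x ≈ 1#
  b-self x = trans (b-unitriangular x x ≺-irrefl) (δ-self x)

  b-idempotent : ∀ x → IsIdempotent (b x)
  b-idempotent x z = begin
    (b x ⊗ b x) z                        ≈⟨ ⊗-expand (b x) (b x) z ⟩
    ∑ (λ s → b x s * (δ s ⊗ b x) z)      ≡⟨ ∑≡sum (λ s → b x s * (δ s ⊗ b x) z) ⟩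
    sum (λ s → b x s * (δ s ⊗ b x) z)    ≈⟨ sum-single x off-diagonal ⟩
    b x x * (δ x ⊗ b x) z                ≈⟨ *-cong (b-self x) (δ⊗-δ⊗ x x (e x) z) ⟩
    1# * (δ (x · x) ⊗ e x) z             ≡⟨ ≡.cong (λ u → 1# * (δ u ⊗ e x) z) (idem x) ⟩
    1# * b x z                           ≈⟨ *-identityˡ (b x z) ⟩
    b x z                                ∎
    where
      off-diagonal : ∀ s → s ≢ x → b x s * (δ s ⊗ b x) z ≈ 0#
      off-diagonal s s≢x with x ≺? s
      ... | no x⊀s =
        trans (*-congʳ (trans (b-unitriangular x s x⊀s) (δ-≢ λ x≡s → s≢x (≡.sym x≡s)))) (zeroˡ _)
      ... | yes (x⪯s , s⋠x) = trans (*-congˡ s·b≈0) (zeroʳ _)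
        where
          s·b≈0 : (δ s ⊗ b x) z ≈ 0#
          s·b≈0 = begin
            (δ s ⊗ b x) z        ≈⟨ δ⊗-δ⊗ s x (e x) z ⟩
            (δ (s · x) ⊗ e x) z  ≡⟨ ≡.cong (λ u → (δ u ⊗ e x) z) x⪯s ⟩
            (δ s ⊗ e x) z        ≈⟨ δ⊗e≋𝟘 x s (λ s⪯r → s⋠x (⪯-trans s⪯r (rep⪯ x))) z ⟩
            0#                   ∎

  b-nonzero : ∀ x → ¬ (b x ≋ 𝟘)
  b-nonzero x b≋𝟘 = 1≉0 (trans (sym (b-self x)) (b≋𝟘 x))

  χ-b : ∀ x y → ¬ (x ∼ y) → χ y (b x) ≈ 0#
  χ-b x y x≁y = trans (χ-δ⊗ y x (e x)) (cond-zeroᵈ (x ⪯? y) χ-e≈0)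
    where
      χ-e≈0 : x ⪯ y → χ y (e x) ≈ 0#
      χ-e≈0 x⪯y = begin
        χ y (e x)
          ≈⟨ cond-yes (y ⪯? y) (⪯-refl y) ⟨
        cond (y ⪯? y) (χ y (e x))
          ≈⟨ χ-δ⊗ y y (e x) ⟨
        χ y (δ y ⊗ e x)
          ≈⟨ sumOver-𝟘 (_⪯? y) (δ⊗e≋𝟘 x y λ y⪯r → x≁y (x⪯y , ⪯-trans y⪯r (rep⪯ x))) ⟩
        0# ∎

  b-primitive : ∀ x → IsPrimitiveIdempotent (b x)
  b-primitive x = b-idempotent x , b-nonzero x , indecomposable
    where
      indecomposable : ¬ (Σ kS λ g → Σ kS λ h →
                          IsIdempotent g × IsIdempotent h × ¬ (g ≋ 𝟘) × ¬ (h ≋ 𝟘) ×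
                          g ⊗ h ≋ 𝟘 × h ⊗ g ≋ 𝟘 × b x ≋ g ⊕ h)
      indecomposable (g , h , g-idem , h-idem , g≉𝟘 , h≉𝟘 , g⊗h≋𝟘 , h⊗g≋𝟘 , b≋g⊕h) =
        h≉𝟘 (idempotent-χ≈0-off-class⇒𝟘 x h-idem χh-off χxh≈0)
        where
          χ-sum : ∀ y → ¬ (x ∼ y) → χ y g + χ y h ≈ 0#
          χ-sum y x≁y = begin
            χ y g + χ y h    ≈⟨ sumOver-⊕ (_⪯? y) g h ⟨
            χ y (g ⊕ h)      ≈⟨ sumOver-cong (_⪯? y) b≋g⊕h ⟨
            χ y (b x)        ≈⟨ χ-b x y x≁y ⟩
            0#               ∎
          χg-off : ∀ y → ¬ (x ∼ y) → χ y g ≈ 0#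
          χg-off y x≁y =
            x*x≈x⇒x*y≈0⇒x+y≈0⇒x≈0 (χ-idempotent y g-idem) (χ-orthogonal y g⊗h≋𝟘) (χ-sum y x≁y)
          χh-off : ∀ y → ¬ (x ∼ y) → χ y h ≈ 0#
          χh-off y x≁y =
            x*x≈x⇒x*y≈0⇒x+y≈0⇒x≈0 (χ-idempotent y h-idem) (χ-orthogonal y h⊗g≋𝟘)
                                   (trans (+-comm (χ y h) (χ y g)) (χ-sum y x≁y))
          χxh≈0 : χ x h ≈ 0#
          χxh≈0 =
            x≉0⇒x*y≈0⇒y≈0 (λ χxg≈0 → g≉𝟘 (idempotent-χ≈0-off-class⇒𝟘 x g-idem χg-off χxg≈0))
                          (χ-orthogonal x g⊗h≋𝟘)

corollary4p4 : ∀ {c ℓ : Level} (K : Field c ℓ) {n : ℕ} (S : LRBWithIdentity n)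
                 (R : Representatives S) →
                 let open SemigroupAlgebra K S in
                 IsBasis (λ x → δ x ⊗ eOf R x)
                 × (∀ x → IsPrimitiveIdempotent (δ x ⊗ eOf R x))
corollary4p4 K S R = unitriangular⇒basis b-unitriangular , b-primitive
  where
    open SemigroupAlgebraProperties K S
    open PrimitiveIdempotents K S R
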